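{- Let $\lambda$ be a partition of $n$. The forgotten symmetric function $f_\lambda\in\mathsf{Sym}$ has saturated Newton polytope if and only if $\lambda=(1^n)$.
   Context: $\mathsf{Sym}$ is the ring of symmetric functions in $x_1,x_2,\ldots$. $m_\lambda$ is the monomial symmetric function (sum of all distinct monomials whose exponent vector is a rearrangement of $\lambda$). $\omega:\mathsf{Sym}\to\mathsf{Sym}$ is the involutive automorphism with $\omega(s_\lambda)=s_{\lambda'}$, $\lambda'$ the conjugate partition. The forgotten symmetric function is $f_\lambda=\varepsilon_\lambda\,\omega(m_\lambda)$ with $\varepsilon_\lambda=(-1)^{|\lambda|-\ell(\lambda)}$, $\ell(\lambda)$ the number of nonzero parts. A polynomial $g=\sum c_\alpha x^\alpha$ has saturated Newton polytope (SNP) if every lattice point of $\mathrm{conv}\{\alpha:c_\alpha\neq0\}$ is an exponent vector with nonzero coefficient; $f\in\mathsf{Sym}$ is SNP if $f(x_1,\ldots,x_m)$ (setting $x_i=0$ for $i>m$) is SNP for every $m\geq1$. -}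

module Defs where

open import Data.Nat as ℕ using (ℕ; zero; suc; _∸_; _<_; _≤ᵇ_; _≡ᵇ_)
open import Data.Nat.Properties using (≤-decTotalOrder)
open import Data.Integer as ℤ using (ℤ; +_; -[1+_])
open import Data.Rational as ℚ using (ℚ; 0ℚ; 1ℚ)
open import Data.Bool using (Bool; true; false; if_then_else_; _∧_)
open import Data.List using (List; []; _∷_; map; foldr; filter; zipWith; replicate; length; concatMap; upTo)
open import Data.List.Properties using (≡-dec)
open import Data.List.Relation.Unary.All using (All)
open import Data.List.Relation.Unary.Linked using (Linked)
open import Data.Vec as Vec using (Vec)
open import Data.Fin using (Fin)
open import Data.Product using (_×_; _,_; ∃; Σ)
open import Relation.Binary.PropositionalEquality using (_≡_; _≢_)
open import Relation.Nullary.Decidable using (does; ¬?)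
import Data.List.Sort.InsertionSort as ISort
open ISort ≤-decTotalOrder using (sort)

-- Elements of Sym (with integer coefficients), encoded by their
-- coefficient function on monomials.  A monomial x₁^a₁ x₂^a₂ ⋯ (finitely
-- many variables involved) is encoded by its exponent list a₁ ∷ a₂ ∷ ⋯ ;
-- trailing zeros are irrelevant for all the functions built below.

SF : Set
SF = List ℕ → ℤ

sumℤ : List ℤ → ℤ
sumℤ = foldr ℤ._+_ (+ 0)

sumℕ : List ℕ → ℕ
sumℕ = foldr ℕ._+_ 0

IsPartition : ℕ → List ℕ → Set
IsPartition n la = Linked ℕ._≥_ la × All (λ k → 0 < k) la × sumℕ la ≡ n


below : List ℕ → List (List ℕ)
below [] = [] ∷ []
below (a ∷ α) = concatMap (λ b → map (b ∷_) (below α)) (upTo (suc a))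

_⊛_ : SF → SF → SF
(g ⊛ h) α = sumℤ (map (λ β → g β ℤ.* h (zipWith _∸_ α β)) (below α))

indicator : Bool → ℤ
indicator true = + 1
indicator false = + 0

oneSF : SF
oneSF α = indicator (sumℕ α ≡ᵇ 0)

eSF : ℕ → SF
eSF k α = indicator (allLe1 α ∧ (sumℕ α ≡ᵇ k))
  where
  allLe1 : List ℕ → Bool
  allLe1 [] = true
  allLe1 (a ∷ as) = (a ≤ᵇ 1) ∧ allLe1 as

hSF : ℕ → SF
hSF k α = indicator (sumℕ α ≡ᵇ k)

eProd : List ℕ → SF
eProd = foldr (λ k acc → eSF k ⊛ acc) oneSF

hProd : List ℕ → SF
hProd = foldr (λ k acc → hSF k ⊛ acc) oneSF

combE : List (ℤ × List ℕ) → SF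
combE c α = sumℤ (map (λ { (z , μ) → z ℤ.* eProd μ α }) c)

combH : List (ℤ × List ℕ) → SF
combH c α = sumℤ (map (λ { (z , μ) → z ℤ.* hProd μ α }) c)

monoSF : List ℕ → SF
monoSF la α = indicator (does (≡-dec ℕ._≟_ (sort (filter (λ a → ¬? (a ℕ.≟ 0)) α)) (sort la)))

-- ω is the linear (indeed ring) involution with ω(e_μ) = h_μ.  Since the
-- e_μ form a ℤ-basis of Sym, if  m_λ = Σ c_μ e_μ  then  ω(m_λ) = Σ c_μ h_μ.
-- ε_λ = (-1)^(|λ| - ℓ(λ))
signPow : ℕ → ℤ
signPow zero = + 1
signPow (suc k) = ℤ.- signPow k

-- forgotten symmetric function f_λ = ε_λ ω(m_λ), computed from an
-- e-expansion c of m_λ (its correctness is a hypothesis where it is used)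
forgottenVia : List ℕ → List (ℤ × List ℕ) → SF
forgottenVia la c α = signPow (sumℕ la ∸ length la) ℤ.* combH c α

Poly : ℕ → Set
Poly m = Vec ℕ m → ℤ

toℚ : ℕ → ℚ
toℚ a = + a ℚ./ 1

sumℚ : List ℚ → ℚ
sumℚ = foldr ℚ._+_ 0ℚ

InNewtonPolytope : ∀ {m} → Poly m → Vec ℕ m → Set
InNewtonPolytope {m} g β =
  Σ (List (ℚ × Vec ℕ m)) λ pts →
      All (λ { (t , α) → (0ℚ ℚ.≤ t) × (g α ≢ + 0) }) pts
    × (sumℚ (map (λ { (t , _) → t }) pts) ≡ 1ℚ)
    × (∀ (i : Fin m) →
         sumℚ (map (λ { (t , α) → t ℚ.* toℚ (Vec.lookup α i) }) pts)
           ≡ toℚ (Vec.lookup β i))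

SNPPoly : ∀ {m} → Poly m → Set
SNPPoly {m} g = ∀ (β : Vec ℕ m) → InNewtonPolytope g β → g β ≢ + 0

-- restriction f(x₁,…,xₘ) of a symmetric function (x_i = 0 for i > m)
restrict : (m : ℕ) → SF → Poly m
restrict m f α = f (Vec.toList α)

SNP : SF → Set
SNP f = ∀ (m : ℕ) → 1 ℕ.≤ m → SNPPoly (restrict m f)

{-# OPTIONS --safe #-}
module Submission where

-- The coefficient of x^α in ω F is a fixed ℤ-linear combination of coefficients of F:
-- writing e_a = ∑_γ (-1)^(a - ℓ γ) h_γ over compositions γ of a and using the symmetry
-- [x^β] e_ν = [x^ν] e_β, it is a signed sum of the coefficients of F at the exponents
-- refining α part by part.  So f_λ is determined by m_λ alone, whatever the expansion c.
--   If λ = 1ⁿ then m_λ = e_n and f_λ = h_n, whose support is every exponent of degree n;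
-- its Newton polytope lies in the hyperplane of degree n, so it is saturated.
--   If λ ≠ 1ⁿ, look at n variables.  The coefficient of x₁⋯xₙ in f_λ is ± m_λ(1ⁿ) = 0.
-- The coefficient of xᵢⁿ is ∑_γ (-1)^(n - ℓ γ) [x^γ] m_λ over compositions γ of n; a
-- nonzero term has ℓ γ = ℓ λ, so all terms have one sign and γ = λ contributes: it is
-- nonzero.  Yet (1,…,1) is the barycentre of the n points n·eᵢ.

open import Defs

open import Algebra.Bundles using (CommutativeRing)
import Algebra.Properties.CommutativeSemigroup as CommSemigroupProps
import Algebra.Properties.Semiring.Sum as SemiringSum
open import Data.Bool using (true; false; _∧_; T)
open import Data.Empty using (⊥-elim)
open import Data.Fin as Fin using (Fin)
import Data.Fin.Properties as FinP
open import Data.Integer as ℤ using (ℤ; 0ℤ; 1ℤ; _+_; _*_; -_)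
import Data.Integer.Properties as ℤP
open import Data.List
  using (List; []; _∷_; _++_; _ʳ++_; foldr; map; filter; replicate; length; reverse; tabulate; concatMap;
         applyUpTo; upTo; zipWith)
import Data.List.Properties as LP
open import Data.List.Properties using (≡-dec)
open import Data.List.Relation.Binary.Permutation.Propositional using (_↭_; ↭-sym; ↭-trans)
import Data.List.Relation.Binary.Permutation.Propositional.Properties as PermP
open import Data.List.Relation.Unary.All as All using (All; []; _∷_)
import Data.List.Relation.Unary.All.Properties as AllP
open import Data.Nat as ℕ using (ℕ; zero; suc; _∸_; _≤ᵇ_; _≡ᵇ_; z≤n; s≤s)
open import Data.Nat.Coprimality as Coprimality using (Coprime)
open import Data.Nat.ListAction.Properties using (sum-↭)
import Data.Nat.Properties as ℕP
open import Data.List.Sort.InsertionSort ℕP.≤-decTotalOrder using (sort)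
open import Data.List.Sort.InsertionSort.Properties ℕP.≤-decTotalOrder using (sort-↭)
open import Data.Product using (Σ; _×_; _,_; proj₁; proj₂)
open import Data.Rational as ℚ using (ℚ; mkℚ; 0ℚ; 1ℚ; 1/_)
import Data.Rational.Properties as ℚP
import Data.Rational.Unnormalised as ℚᵘ
import Data.Rational.Unnormalised.Properties as ℚᵘP
open import Data.Sum using (_⊎_; inj₁; inj₂; [_,_]′)
open import Data.Vec as Vec using (Vec)
import Data.Vec.Properties as VecP
open import Function using (_∘_; id; const)
open import Function.Bundles using (_⇔_; mk⇔)
open import Relation.Binary.PropositionalEquality
open import Relation.Nullary using (yes; no; ¬_; contradiction)
open import Relation.Nullary.Decidable using (¬?; decidable-stable)

open CommSemigroupProps ℤP.+-commutativeSemigroup using (interchange)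
open CommSemigroupProps ℤP.*-commutativeSemigroup using (x∙yz≈y∙xz)

∑≤ : ℕ → (ℕ → ℤ) → ℤ
∑≤ zero    g = g 0
∑≤ (suc a) g = g 0 + ∑≤ a (g ∘ suc)

syntax ∑≤ a (λ i → x) = ∑[ i ≤ a ] x

∑antidiag : ℕ → (ℕ → ℕ → ℤ) → ℤ
∑antidiag a ψ = ∑[ b ≤ a ] ψ b (a ∸ b)

syntax ∑antidiag a (λ b c → x) = ∑[ b + c ≡ a ] x

∑≤-cong-≤ : ∀ a {g g′ : ℕ → ℤ} → (∀ i → i ℕ.≤ a → g i ≡ g′ i) → ∑≤ a g ≡ ∑≤ a g′
∑≤-cong-≤ zero    eq = eq 0 z≤n
∑≤-cong-≤ (suc a) eq = cong₂ _+_ (eq 0 z≤n) (∑≤-cong-≤ a (λ i i≤a → eq (suc i) (s≤s i≤a)))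

∑≤-cong : ∀ a {g g′ : ℕ → ℤ} → g ≗ g′ → ∑≤ a g ≡ ∑≤ a g′
∑≤-cong a eq = ∑≤-cong-≤ a (λ i _ → eq i)

∑≤-zero : ∀ a {g : ℕ → ℤ} → (∀ i → g i ≡ 0ℤ) → ∑≤ a g ≡ 0ℤ
∑≤-zero zero    eq = eq 0
∑≤-zero (suc a) eq = cong₂ _+_ (eq 0) (∑≤-zero a (eq ∘ suc))

∑≤-distrib-+ : ∀ a (g g′ : ℕ → ℤ) → ∑[ i ≤ a ] (g i + g′ i) ≡ ∑≤ a g + ∑≤ a g′
∑≤-distrib-+ zero    g g′ = refl
∑≤-distrib-+ (suc a) g g′ =
  trans (cong ((g 0 + g′ 0) +_) (∑≤-distrib-+ a (g ∘ suc) (g′ ∘ suc))) (interchange (g 0) (g′ 0) _ _)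

*-distribˡ-∑≤ : ∀ a z (g : ℕ → ℤ) → z * ∑≤ a g ≡ ∑[ i ≤ a ] (z * g i)
*-distribˡ-∑≤ zero    z g = refl
*-distribˡ-∑≤ (suc a) z g = trans (ℤP.*-distribˡ-+ z (g 0) _) (cong (z * g 0 +_) (*-distribˡ-∑≤ a z (g ∘ suc)))

neg-distrib-∑≤ : ∀ a (g : ℕ → ℤ) → - ∑≤ a g ≡ ∑[ i ≤ a ] (- g i)
neg-distrib-∑≤ zero    g = refl
neg-distrib-∑≤ (suc a) g = trans (ℤP.neg-distrib-+ (g 0) _) (cong (- g 0 +_) (neg-distrib-∑≤ a (g ∘ suc)))

∑≤-init-last : ∀ a (g : ℕ → ℤ) → ∑≤ (suc a) g ≡ ∑≤ a g + g (suc a)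
∑≤-init-last zero    g = refl
∑≤-init-last (suc a) g = trans (cong (g 0 +_) (∑≤-init-last a (g ∘ suc))) (sym (ℤP.+-assoc (g 0) _ _))

∑antidiag-init-last : ∀ a (ψ : ℕ → ℕ → ℤ) →
  ∑antidiag (suc a) ψ ≡ ∑[ b + c ≡ a ] ψ b (suc c) + ψ (suc a) 0
∑antidiag-init-last a ψ = trans (∑≤-init-last a _)
  (cong₂ _+_ (∑≤-cong-≤ a (λ b b≤a → cong (ψ b) (ℕP.+-∸-assoc 1 b≤a))) (cong (ψ (suc a)) (ℕP.n∸n≡0 a)))

∑antidiag-assoc : ∀ a (X : ℕ → ℕ → ℕ → ℤ) →
  ∑[ b + c ≡ a ] ∑[ b₁ + b₂ ≡ b ] X b₁ b₂ c ≡ ∑[ b₁ + r ≡ a ] ∑[ b₂ + c ≡ r ] X b₁ b₂ c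
∑antidiag-assoc zero    X = refl
∑antidiag-assoc (suc a) X = begin
  X 0 0 (suc a) + ∑[ b + c ≡ a ] (X 0 (suc b) c + ∑[ b₁ + b₂ ≡ b ] X (suc b₁) b₂ c)
    ≡⟨ cong (X 0 0 (suc a) +_) (∑≤-distrib-+ a _ _) ⟩
  X 0 0 (suc a) + (∑[ b + c ≡ a ] X 0 (suc b) c + ∑[ b + c ≡ a ] ∑[ b₁ + b₂ ≡ b ] X (suc b₁) b₂ c)
    ≡⟨ sym (ℤP.+-assoc (X 0 0 (suc a)) _ _) ⟩
  (X 0 0 (suc a) + ∑[ b + c ≡ a ] X 0 (suc b) c) + ∑[ b + c ≡ a ] ∑[ b₁ + b₂ ≡ b ] X (suc b₁) b₂ c
    ≡⟨ cong ((X 0 0 (suc a) + ∑[ b + c ≡ a ] X 0 (suc b) c) +_) (∑antidiag-assoc a (X ∘ suc)) ⟩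
  (X 0 0 (suc a) + ∑[ b + c ≡ a ] X 0 (suc b) c) + ∑[ b₁ + r ≡ a ] ∑[ b₂ + c ≡ r ] X (suc b₁) b₂ c ∎
  where open ≡-Reasoning

-- The product of Sym, computed coefficientwise

slice : ℕ → SF → SF
slice b F β = F (b ∷ β)

infixl 6 _⊕_
infixl 7 _·_ _⋆_

_⊕_ : SF → SF → SF
(F ⊕ G) α = F α + G α

_·_ : ℤ → SF → SF
(z · F) α = z * F α

_⋆_ : SF → SF → SF
(F ⋆ G) []      = F [] * G []
(F ⋆ G) (a ∷ α) = ∑[ b + c ≡ a ] (slice b F ⋆ slice c G) α

⋆-cong : ∀ {F F′ G G′} → F ≗ F′ → G ≗ G′ → F ⋆ G ≗ F′ ⋆ G′
⋆-cong F≗F′ G≗G′ []      = cong₂ _*_ (F≗F′ []) (G≗G′ [])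
⋆-cong F≗F′ G≗G′ (a ∷ α) =
  ∑≤-cong a (λ b → ⋆-cong (F≗F′ ∘ (b ∷_)) (G≗G′ ∘ (a ∸ b ∷_)) α)

⋆-congʳ : ∀ F {G G′} → G ≗ G′ → F ⋆ G ≗ F ⋆ G′
⋆-congʳ F = ⋆-cong {F} (λ _ → refl)

⋆-congˡ : ∀ {F F′} G → F ≗ F′ → F ⋆ G ≗ F′ ⋆ G
⋆-congˡ G F≗F′ = ⋆-cong F≗F′ (λ _ → refl)

⋆-distribʳ-⊕ : ∀ F F′ G → (F ⊕ F′) ⋆ G ≗ F ⋆ G ⊕ F′ ⋆ G
⋆-distribʳ-⊕ F F′ G []      = ℤP.*-distribʳ-+ (G []) (F []) (F′ [])
⋆-distribʳ-⊕ F F′ G (a ∷ α) =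
  trans (∑≤-cong a (λ b → ⋆-distribʳ-⊕ (slice b F) (slice b F′) (slice (a ∸ b) G) α))
        (∑≤-distrib-+ a _ _)

⋆-distribˡ-⊕ : ∀ F G G′ → F ⋆ (G ⊕ G′) ≗ F ⋆ G ⊕ F ⋆ G′
⋆-distribˡ-⊕ F G G′ []      = ℤP.*-distribˡ-+ (F []) (G []) (G′ [])
⋆-distribˡ-⊕ F G G′ (a ∷ α) =
  trans (∑≤-cong a (λ b → ⋆-distribˡ-⊕ (slice b F) (slice (a ∸ b) G) (slice (a ∸ b) G′) α))
        (∑≤-distrib-+ a _ _)

⋆-scalarˡ : ∀ z F G → (z · F) ⋆ G ≗ z · (F ⋆ G)
⋆-scalarˡ z F G []      = ℤP.*-assoc z (F []) (G [])
⋆-scalarˡ z F G (a ∷ α) =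
  trans (∑≤-cong a (λ b → ⋆-scalarˡ z (slice b F) (slice (a ∸ b) G) α)) (sym (*-distribˡ-∑≤ a z _))

⋆-scalarʳ : ∀ z F G → F ⋆ (z · G) ≗ z · (F ⋆ G)
⋆-scalarʳ z F G []      = x∙yz≈y∙xz (F []) z (G [])
⋆-scalarʳ z F G (a ∷ α) =
  trans (∑≤-cong a (λ b → ⋆-scalarʳ z (slice b F) (slice (a ∸ b) G) α)) (sym (*-distribˡ-∑≤ a z _))

⋆-zeroˡ : ∀ {F} G → F ≗ const 0ℤ → F ⋆ G ≗ const 0ℤ
⋆-zeroˡ G F≗0 []      = cong (_* G []) (F≗0 [])
⋆-zeroˡ G F≗0 (a ∷ α) = ∑≤-zero a (λ b → ⋆-zeroˡ (slice (a ∸ b) G) (F≗0 ∘ (b ∷_)) α)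

⋆-zeroʳ : ∀ F {G} → G ≗ const 0ℤ → F ⋆ G ≗ const 0ℤ
⋆-zeroʳ F G≗0 []      = trans (cong (F [] *_) (G≗0 [])) (ℤP.*-zeroʳ (F []))
⋆-zeroʳ F G≗0 (a ∷ α) = ∑≤-zero a (λ b → ⋆-zeroʳ (slice b F) (G≗0 ∘ (a ∸ b ∷_)) α)

⋆-∑ˡ : ∀ n (Φ : ℕ → SF) G → (λ x → ∑[ i ≤ n ] Φ i x) ⋆ G ≗ (λ α → ∑[ i ≤ n ] (Φ i ⋆ G) α)
⋆-∑ˡ zero    Φ G α = refl
⋆-∑ˡ (suc n) Φ G α =
  trans (⋆-distribʳ-⊕ (Φ 0) _ G α) (cong ((Φ 0 ⋆ G) α +_) (⋆-∑ˡ n (Φ ∘ suc) G α))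

⋆-∑ʳ : ∀ n F (Φ : ℕ → SF) → F ⋆ (λ x → ∑[ i ≤ n ] Φ i x) ≗ (λ α → ∑[ i ≤ n ] (F ⋆ Φ i) α)
⋆-∑ʳ zero    F Φ α = refl
⋆-∑ʳ (suc n) F Φ α =
  trans (⋆-distribˡ-⊕ F (Φ 0) _ α) (cong ((F ⋆ Φ 0) α +_) (⋆-∑ʳ n F (Φ ∘ suc) α))

⋆-assoc : ∀ F G H → (F ⋆ G) ⋆ H ≗ F ⋆ (G ⋆ H)
⋆-assoc F G H []      = ℤP.*-assoc (F []) (G []) (H [])
⋆-assoc F G H (a ∷ α) = begin
  ∑[ b + c ≡ a ] (slice b (F ⋆ G) ⋆ slice c H) α
    ≡⟨ ∑≤-cong a (λ b → ⋆-∑ˡ b (λ b₁ → slice b₁ F ⋆ slice (b ∸ b₁) G) (slice (a ∸ b) H) α) ⟩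
  ∑[ b + c ≡ a ] ∑[ b₁ + b₂ ≡ b ] ((slice b₁ F ⋆ slice b₂ G) ⋆ slice c H) α
    ≡⟨ ∑≤-cong a (λ b → ∑≤-cong b (λ b₁ →
         ⋆-assoc (slice b₁ F) (slice (b ∸ b₁) G) (slice (a ∸ b) H) α)) ⟩
  ∑[ b + c ≡ a ] ∑[ b₁ + b₂ ≡ b ] (slice b₁ F ⋆ (slice b₂ G ⋆ slice c H)) α
    ≡⟨ ∑antidiag-assoc a (λ b₁ b₂ c → (slice b₁ F ⋆ (slice b₂ G ⋆ slice c H)) α) ⟩
  ∑[ b₁ + r ≡ a ] ∑[ b₂ + c ≡ r ] (slice b₁ F ⋆ (slice b₂ G ⋆ slice c H)) α
    ≡⟨ ∑≤-cong a (λ b₁ →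
         ⋆-∑ʳ (a ∸ b₁) (slice b₁ F) (λ b₂ → slice b₂ G ⋆ slice (a ∸ b₁ ∸ b₂) H) α) ⟨
  ∑[ b₁ + r ≡ a ] (slice b₁ F ⋆ slice r (G ⋆ H)) α ∎
  where open ≡-Reasoning

⋆-identityʳ : ∀ F → F ⋆ oneSF ≗ F
⋆-identityʳ F []          = ℤP.*-identityʳ (F [])
⋆-identityʳ F (zero ∷ α)  = ⋆-identityʳ (slice 0 F) α
⋆-identityʳ F (suc a ∷ α) = begin
  ∑[ b + c ≡ suc a ] (slice b F ⋆ slice c oneSF) α
    ≡⟨ ∑antidiag-init-last a (λ b c → (slice b F ⋆ slice c oneSF) α) ⟩
  ∑[ b + c ≡ a ] (slice b F ⋆ slice (suc c) oneSF) α + (slice (suc a) F ⋆ oneSF) α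
    ≡⟨ cong (_+ (slice (suc a) F ⋆ oneSF) α) (∑≤-zero a (λ b → ⋆-zeroʳ (slice b F) (λ _ → refl) α)) ⟩
  0ℤ + (slice (suc a) F ⋆ oneSF) α
    ≡⟨ ℤP.+-identityˡ _ ⟩
  (slice (suc a) F ⋆ oneSF) α
    ≡⟨ ⋆-identityʳ (slice (suc a) F) α ⟩
  F (suc a ∷ α) ∎
  where open ≡-Reasoning

⋆-identityˡ : ∀ G → oneSF ⋆ G ≗ G
⋆-identityˡ G []          = ℤP.*-identityˡ (G [])
⋆-identityˡ G (zero ∷ α)  = ⋆-identityˡ (slice 0 G) α
⋆-identityˡ G (suc a ∷ α) = begin
  (oneSF ⋆ slice (suc a) G) α + ∑[ b + c ≡ a ] (slice (suc b) oneSF ⋆ slice (a ∸ b) G) α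
    ≡⟨ cong ((oneSF ⋆ slice (suc a) G) α +_)
            (∑≤-zero a (λ b → ⋆-zeroˡ (slice (a ∸ b) G) (λ _ → refl) α)) ⟩
  (oneSF ⋆ slice (suc a) G) α + 0ℤ
    ≡⟨ ℤP.+-identityʳ _ ⟩
  (oneSF ⋆ slice (suc a) G) α
    ≡⟨ ⋆-identityˡ (slice (suc a) G) α ⟩
  G (suc a ∷ α) ∎
  where open ≡-Reasoning

⋆-exchange : ∀ (A B : SF) (X : List ℕ → List ℕ → ℤ) ν →
  A ⋆ (λ β → (B ⋆ (λ ρ → X ρ β)) ν) ≗ (λ β → (B ⋆ (λ ρ → (A ⋆ X ρ) β)) ν)
⋆-exchange A B X ν []      = sym (⋆-scalarʳ (A []) B (λ ρ → X ρ []) ν)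
⋆-exchange A B X ν (a ∷ β) = trans
  (∑≤-cong a (λ b → ⋆-exchange (slice b A) B (λ ρ → slice (a ∸ b) (X ρ)) ν β))
  (sym (⋆-∑ʳ a B (λ b ρ → (slice b A ⋆ slice (a ∸ b) (X ρ)) β) ν))

sumℤ-++ : ∀ xs ys → sumℤ (xs ++ ys) ≡ sumℤ xs + sumℤ ys
sumℤ-++ []       ys = sym (ℤP.+-identityˡ _)
sumℤ-++ (x ∷ xs) ys = trans (cong (x +_) (sumℤ-++ xs ys)) (sym (ℤP.+-assoc x _ _))

sumℤ-map-concatMap : ∀ {A B : Set} (φ : B → ℤ) (f : A → List B) xs →
  sumℤ (map φ (concatMap f xs)) ≡ sumℤ (map (λ x → sumℤ (map φ (f x))) xs)
sumℤ-map-concatMap φ f []       = refl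
sumℤ-map-concatMap φ f (x ∷ xs) = begin
  sumℤ (map φ (f x ++ concatMap f xs))
    ≡⟨ cong sumℤ (LP.map-++ φ (f x) _) ⟩
  sumℤ (map φ (f x) ++ map φ (concatMap f xs))
    ≡⟨ sumℤ-++ (map φ (f x)) _ ⟩
  sumℤ (map φ (f x)) + sumℤ (map φ (concatMap f xs))
    ≡⟨ cong (sumℤ (map φ (f x)) +_) (sumℤ-map-concatMap φ f xs) ⟩
  sumℤ (map φ (f x)) + sumℤ (map (λ x → sumℤ (map φ (f x))) xs) ∎
  where open ≡-Reasoning

sumℤ-map-applyUpTo : ∀ a (g : ℕ → ℤ) (f : ℕ → ℕ) →
  sumℤ (map g (applyUpTo f (suc a))) ≡ ∑[ i ≤ a ] g (f i)
sumℤ-map-applyUpTo zero    g f = ℤP.+-identityʳ _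
sumℤ-map-applyUpTo (suc a) g f = cong (g (f 0) +_) (sumℤ-map-applyUpTo a g (f ∘ suc))

⊛≗⋆ : ∀ F G → F ⊛ G ≗ F ⋆ G
⊛≗⋆ F G []      = ℤP.+-identityʳ _
⊛≗⋆ F G (a ∷ α) = begin
  sumℤ (map φ (concatMap (λ b → map (b ∷_) (below α)) (upTo (suc a))))
    ≡⟨ sumℤ-map-concatMap φ (λ b → map (b ∷_) (below α)) (upTo (suc a)) ⟩
  sumℤ (map (λ b → sumℤ (map φ (map (b ∷_) (below α)))) (upTo (suc a)))
    ≡⟨ cong sumℤ (LP.map-cong (λ b → cong sumℤ (sym (LP.map-∘ (below α)))) (upTo (suc a))) ⟩
  sumℤ (map (λ b → (slice b F ⊛ slice (a ∸ b) G) α) (upTo (suc a)))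
    ≡⟨ cong sumℤ (LP.map-cong (λ b → ⊛≗⋆ (slice b F) (slice (a ∸ b) G) α) (upTo (suc a))) ⟩
  sumℤ (map (λ b → (slice b F ⋆ slice (a ∸ b) G) α) (upTo (suc a)))
    ≡⟨ sumℤ-map-applyUpTo a _ id ⟩
  (F ⋆ G) (a ∷ α) ∎
  where
  open ≡-Reasoning
  φ : List ℕ → ℤ
  φ β = F β * G (zipWith _∸_ (a ∷ α) β)

-- homog κ k is the degree-k part of ∏ᵢ ∑_b κ b · xᵢ^b: e_k for κ = [b ≤ 1], h_k for κ = 1.
homog : (ℕ → ℤ) → ℕ → SF
homog κ k []      = indicator (k ≡ᵇ 0)
homog κ k (b ∷ β) = indicator (b ≤ᵇ k) * κ b * homog κ (k ∸ b) β

homogProd : (ℕ → ℤ) → List ℕ → SF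
homogProd κ = foldr (λ k G → homog κ k ⋆ G) oneSF

κₑ κₕ : ℕ → ℤ
κₑ b = indicator (b ≤ᵇ 1)
κₕ b = 1ℤ

e h : ℕ → SF
e = homog κₑ
h = homog κₕ

≤ᵇ-suc : ∀ b k → (suc b ≤ᵇ suc k) ≡ (b ≤ᵇ k)
≤ᵇ-suc zero    k = refl
≤ᵇ-suc (suc b) k = refl

indicator-+≡ᵇ : ∀ b s k →
  indicator (b ℕ.+ s ≡ᵇ k) ≡ indicator (b ≤ᵇ k) * κₕ b * indicator (s ≡ᵇ k ∸ b)
indicator-+≡ᵇ zero    s k       = sym (ℤP.*-identityˡ _)
indicator-+≡ᵇ (suc b) s zero    = refl
indicator-+≡ᵇ (suc b) s (suc k) =
  trans (indicator-+≡ᵇ b s k) (cong (λ t → indicator t * 1ℤ * indicator (s ≡ᵇ k ∸ b)) (sym (≤ᵇ-suc b k)))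

-- A abstracts the test, local to eSF, that the remaining exponents are at most 1.
indicator-∧-+≡ᵇ : ∀ A b s k →
  indicator (((b ≤ᵇ 1) ∧ A) ∧ (b ℕ.+ s ≡ᵇ k)) ≡
  indicator (b ≤ᵇ k) * κₑ b * indicator (A ∧ (s ≡ᵇ k ∸ b))
indicator-∧-+≡ᵇ A     zero             s k       = sym (ℤP.*-identityˡ _)
indicator-∧-+≡ᵇ true  (suc zero)       s zero    = refl
indicator-∧-+≡ᵇ false (suc zero)       s zero    = refl
indicator-∧-+≡ᵇ true  (suc zero)       s (suc k) = sym (ℤP.*-identityˡ _)
indicator-∧-+≡ᵇ false (suc zero)       s (suc k) = refl
indicator-∧-+≡ᵇ A     (suc (suc b))    s k       =
  sym (trans (cong (_* indicator (A ∧ (s ≡ᵇ k ∸ suc (suc b)))) (ℤP.*-zeroʳ (indicator (suc (suc b) ≤ᵇ k))))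
             (ℤP.*-zeroˡ (indicator (A ∧ (s ≡ᵇ k ∸ suc (suc b))))))

hSF≗h : ∀ k → hSF k ≗ h k
hSF≗h zero    []      = refl
hSF≗h (suc k) []      = refl
hSF≗h k       (b ∷ β) =
  trans (indicator-+≡ᵇ b (sumℕ β) k) (cong (indicator (b ≤ᵇ k) * 1ℤ *_) (hSF≗h (k ∸ b) β))

eSF≗e : ∀ k → eSF k ≗ e k
eSF≗e zero    []      = refl
eSF≗e (suc k) []      = refl
eSF≗e k       (b ∷ β) =
  trans (indicator-∧-+≡ᵇ _ b (sumℕ β) k) (cong (indicator (b ≤ᵇ k) * κₑ b *_) (eSF≗e (k ∸ b) β))

hProd≗homogProd : ∀ μ → hProd μ ≗ homogProd κₕ μ
hProd≗homogProd []      x = refl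
hProd≗homogProd (k ∷ μ) x = trans (⊛≗⋆ (hSF k) (hProd μ) x) (⋆-cong (hSF≗h k) (hProd≗homogProd μ) x)

eProd≗homogProd : ∀ μ → eProd μ ≗ homogProd κₑ μ
eProd≗homogProd []      x = refl
eProd≗homogProd (k ∷ μ) x = trans (⊛≗⋆ (eSF k) (eProd μ) x) (⋆-cong (eSF≗e k) (eProd≗homogProd μ) x)

∑≤-indicator-comm : ∀ g k (φ : ℕ → ℤ) →
  ∑[ b ≤ g ] (indicator (b ≤ᵇ k) * φ b) ≡ ∑[ b ≤ k ] (indicator (b ≤ᵇ g) * φ b)
∑≤-indicator-comm zero    zero    φ = refl
∑≤-indicator-comm zero    (suc k) φ =
  sym (trans (cong (1ℤ * φ 0 +_) (∑≤-zero k (λ i → ℤP.*-zeroˡ (φ (suc i))))) (ℤP.+-identityʳ _))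
∑≤-indicator-comm (suc g) zero    φ =
  trans (cong (1ℤ * φ 0 +_) (∑≤-zero g (λ i → ℤP.*-zeroˡ (φ (suc i))))) (ℤP.+-identityʳ _)
∑≤-indicator-comm (suc g) (suc k) φ = cong (1ℤ * φ 0 +_) (begin
  ∑[ b ≤ g ] (indicator (suc b ≤ᵇ suc k) * φ (suc b))
    ≡⟨ ∑≤-cong g (λ b → cong (λ t → indicator t * φ (suc b)) (≤ᵇ-suc b k)) ⟩
  ∑[ b ≤ g ] (indicator (b ≤ᵇ k) * φ (suc b))
    ≡⟨ ∑≤-indicator-comm g k (φ ∘ suc) ⟩
  ∑[ b ≤ k ] (indicator (b ≤ᵇ g) * φ (suc b))
    ≡⟨ ∑≤-cong k (λ b → cong (λ t → indicator t * φ (suc b)) (≤ᵇ-suc b g)) ⟨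
  ∑[ b ≤ k ] (indicator (suc b ≤ᵇ suc g) * φ (suc b)) ∎)
  where open ≡-Reasoning

-- The symmetry [x^β] homogProd κ ν = [x^ν] homogProd κ β, in recursive form.
homogProd-transpose : ∀ κ ν g β → homogProd κ ν (g ∷ β) ≡ (homog κ g ⋆ (λ ρ → homogProd κ ρ β)) ν
homogProd-transpose κ []      zero    β = sym (ℤP.*-identityˡ _)
homogProd-transpose κ []      (suc g) β = sym (ℤP.*-zeroˡ (oneSF β))
homogProd-transpose κ (k ∷ ν) g       β = begin
  ∑[ b + c ≡ g ] (slice b (homog κ k) ⋆ slice c (homogProd κ ν)) β
    ≡⟨ ∑≤-cong g (λ b → ⋆-scalarˡ (w b k) (homog κ (k ∸ b)) (slice (g ∸ b) (homogProd κ ν)) β) ⟩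
  ∑[ b + c ≡ g ] (w b k * (homog κ (k ∸ b) ⋆ slice c (homogProd κ ν)) β)
    ≡⟨ ∑≤-cong g (λ b → cong (w b k *_)
         (⋆-congʳ (homog κ (k ∸ b)) (λ β′ → homogProd-transpose κ ν (g ∸ b) β′) β)) ⟩
  ∑[ b + c ≡ g ] (w b k * (homog κ (k ∸ b) ⋆ (λ β′ → (homog κ c ⋆ (λ ρ → homogProd κ ρ β′)) ν)) β)
    ≡⟨ ∑≤-cong g (λ b → cong (w b k *_)
         (⋆-exchange (homog κ (k ∸ b)) (homog κ (g ∸ b)) (λ ρ → homogProd κ ρ) ν β)) ⟩
  ∑[ b ≤ g ] (w b k * Z (g ∸ b) (k ∸ b))
    ≡⟨ ∑≤-cong g (λ b → ℤP.*-assoc (indicator (b ≤ᵇ k)) (κ b) _) ⟩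
  ∑[ b ≤ g ] (indicator (b ≤ᵇ k) * (κ b * Z (g ∸ b) (k ∸ b)))
    ≡⟨ ∑≤-indicator-comm g k (λ b → κ b * Z (g ∸ b) (k ∸ b)) ⟩
  ∑[ b ≤ k ] (indicator (b ≤ᵇ g) * (κ b * Z (g ∸ b) (k ∸ b)))
    ≡⟨ ∑≤-cong k (λ b → ℤP.*-assoc (indicator (b ≤ᵇ g)) (κ b) _) ⟨
  ∑[ b ≤ k ] (w b g * Z (g ∸ b) (k ∸ b))
    ≡⟨ ∑≤-cong k (λ b →
         ⋆-scalarˡ (w b g) (homog κ (g ∸ b)) (λ ρ → (homog κ (k ∸ b) ⋆ homogProd κ ρ) β) ν) ⟨
  ∑[ b + c ≡ k ] (slice b (homog κ g) ⋆ slice c (λ ρ → homogProd κ ρ β)) ν ∎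
  where
  open ≡-Reasoning
  w : ℕ → ℕ → ℤ
  w b k′ = indicator (b ≤ᵇ k′) * κ b
  Z : ℕ → ℕ → ℤ
  Z c m = (homog κ c ⋆ (λ ρ → (homog κ m ⋆ homogProd κ ρ) β)) ν

slice-zero-homog : ∀ κ → κ 0 ≡ 1ℤ → ∀ k → slice 0 (homog κ k) ≗ homog κ k
slice-zero-homog κ κ0≡1 k y = trans (cong (λ t → 1ℤ * t * homog κ k y) κ0≡1) (ℤP.*-identityˡ _)

homog-zero : ∀ κ → κ 0 ≡ 1ℤ → homog κ 0 ≗ oneSF
homog-zero κ κ0≡1 []          = refl
homog-zero κ κ0≡1 (zero ∷ β)  = trans (slice-zero-homog κ κ0≡1 0 β) (homog-zero κ κ0≡1 β)
homog-zero κ κ0≡1 (suc b ∷ β) = ℤP.*-zeroˡ (homog κ 0 β)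

-- The relation ∑ⱼ (-1)ʲ h_(a-j) e_j = [a = 0]

slice-suc-h : ∀ c m → slice (suc c) (h (suc m)) ≗ slice c (h m)
slice-suc-h c m y = cong (λ t → indicator t * 1ℤ * h (m ∸ c) y) (≤ᵇ-suc c m)

slice-suc-h-zero : ∀ c → slice (suc c) (h 0) ≗ const 0ℤ
slice-suc-h-zero c y = ℤP.*-zeroˡ (h 0 y)

slice-one-e-suc : ∀ j → slice 1 (e (suc j)) ≗ e j
slice-one-e-suc j y = ℤP.*-identityˡ (e j y)

slice-one-e-zero : slice 1 (e 0) ≗ const 0ℤ
slice-one-e-zero y = ℤP.*-zeroˡ (e 0 y)

slice-suc-suc-e : ∀ d j → slice (2 ℕ.+ d) (e j) ≗ const 0ℤ
slice-suc-suc-e d j y = trans (cong (_* e (j ∸ (2 ℕ.+ d)) y) (ℤP.*-zeroʳ (indicator (2 ℕ.+ d ≤ᵇ j))))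
                              (ℤP.*-zeroˡ (e (j ∸ (2 ℕ.+ d)) y))

⋆-cons-≤1 : ∀ F G → (∀ d → slice (2 ℕ.+ d) G ≗ const 0ℤ) → ∀ c x →
  (F ⋆ G) (suc c ∷ x) ≡ (slice c F ⋆ slice 1 G) x + (slice (suc c) F ⋆ slice 0 G) x
⋆-cons-≤1 F G G≤1 c x = trans (∑antidiag-init-last c (λ b d → (slice b F ⋆ slice d G) x))
                               (cong (_+ (slice (suc c) F ⋆ slice 0 G) x) (upper c))
  where
  upper : ∀ c → ∑[ b + d ≡ c ] (slice b F ⋆ slice (suc d) G) x ≡ (slice c F ⋆ slice 1 G) x
  upper zero    = refl
  upper (suc c) = begin
    ∑[ b + d ≡ suc c ] (slice b F ⋆ slice (suc d) G) x
      ≡⟨ ∑antidiag-init-last c (λ b d → (slice b F ⋆ slice (suc d) G) x) ⟩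
    ∑[ b + d ≡ c ] (slice b F ⋆ slice (2 ℕ.+ d) G) x + (slice (suc c) F ⋆ slice 1 G) x
      ≡⟨ cong (_+ (slice (suc c) F ⋆ slice 1 G) x)
              (∑≤-zero c (λ b → ⋆-zeroʳ (slice b F) (G≤1 (c ∸ b)) x)) ⟩
    0ℤ + (slice (suc c) F ⋆ slice 1 G) x
      ≡⟨ ℤP.+-identityˡ _ ⟩
    (slice (suc c) F ⋆ slice 1 G) x ∎
    where open ≡-Reasoning

alternating-telescope : ∀ a (R P : ℕ → ℤ) → R 0 ≡ 0ℤ → P (suc a) ≡ 0ℤ →
  (∀ j → j ℕ.≤ a → R (suc j) ≡ P j) → ∑[ j ≤ suc a ] (signPow j * (R j + P j)) ≡ 0ℤ
alternating-telescope a R P R₀≡0 Pₗ≡0 shift = begin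
  ∑[ j ≤ suc a ] (signPow j * (R j + P j))
    ≡⟨ ∑≤-cong (suc a) (λ j → ℤP.*-distribˡ-+ (signPow j) (R j) (P j)) ⟩
  ∑[ j ≤ suc a ] (signPow j * R j + signPow j * P j)
    ≡⟨ ∑≤-distrib-+ (suc a) (λ j → signPow j * R j) (λ j → signPow j * P j) ⟩
  (1ℤ * R 0 + ∑[ j ≤ a ] (signPow (suc j) * R (suc j))) + ∑[ j ≤ suc a ] (signPow j * P j)
    ≡⟨ cong₂ _+_ (cong₂ _+_ (trans (ℤP.*-identityˡ _) R₀≡0) (∑≤-cong-≤ a shifted)) (∑≤-init-last a _) ⟩
  (0ℤ + ∑[ j ≤ a ] (- (signPow j * P j))) + (ΣP + signPow (suc a) * P (suc a))
    ≡⟨ cong₂ _+_ (trans (ℤP.+-identityˡ _) (sym (neg-distrib-∑≤ a _)))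
                 (cong (λ t → ΣP + signPow (suc a) * t) Pₗ≡0) ⟩
  - ΣP + (ΣP + signPow (suc a) * 0ℤ)
    ≡⟨ cong (- ΣP +_) (trans (cong (ΣP +_) (ℤP.*-zeroʳ (signPow (suc a)))) (ℤP.+-identityʳ ΣP)) ⟩
  - ΣP + ΣP
    ≡⟨ ℤP.+-inverseˡ ΣP ⟩
  0ℤ ∎
  where
  open ≡-Reasoning
  ΣP : ℤ
  ΣP = ∑[ j ≤ a ] (signPow j * P j)
  shifted : ∀ j → j ℕ.≤ a → signPow (suc j) * R (suc j) ≡ - (signPow j * P j)
  shifted j j≤a = trans (cong (signPow (suc j) *_) (shift j j≤a)) (sym (ℤP.neg-distribˡ-* (signPow j) (P j)))

h⋆e-alternating : ∀ a →
  (λ x → ∑[ j ≤ a ] (signPow j * (h (a ∸ j) ⋆ e j) x)) ≗ indicator (a ≡ᵇ 0) · oneSF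
h⋆e-alternating zero    []          = refl
h⋆e-alternating (suc a) []          =
  trans (ℤP.+-identityˡ _) (∑≤-zero a (λ j →
    trans (cong (signPow (suc j) *_) (ℤP.*-zeroʳ (h (a ∸ j) []))) (ℤP.*-zeroʳ (signPow (suc j)))))
h⋆e-alternating a       (zero ∷ x)  = trans
  (∑≤-cong a (λ j → cong (signPow j *_)
    (⋆-cong (slice-zero-homog κₕ refl (a ∸ j)) (slice-zero-homog κₑ refl j) x)))
  (h⋆e-alternating a x)
h⋆e-alternating zero    (suc c ∷ x) =
  trans (ℤP.*-identityˡ _) (trans (⋆-cons-≤1 (h 0) (e 0) (λ d → slice-suc-suc-e d 0) c x)
  (cong₂ _+_ (⋆-zeroʳ (slice c (h 0)) slice-one-e-zero x) (⋆-zeroˡ (slice 0 (e 0)) (slice-suc-h-zero c) x)))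
-- Only x₁⁰ and x₁¹ occur in e_j, so each term splits in two and neighbouring halves cancel.
h⋆e-alternating (suc a) (suc c ∷ x) = trans
  (∑≤-cong (suc a) (λ j → cong (signPow j *_)
    (⋆-cons-≤1 (h (suc a ∸ j)) (e j) (λ d → slice-suc-suc-e d j) c x)))
  (alternating-telescope a R P (⋆-zeroʳ (slice c (h (suc a))) slice-one-e-zero x) Pₗ≡0 R∘suc≡P)
  where
  R P : ℕ → ℤ
  R j = (slice c (h (suc a ∸ j)) ⋆ slice 1 (e j)) x
  P j = (slice (suc c) (h (suc a ∸ j)) ⋆ slice 0 (e j)) x
  Pₗ≡0 : P (suc a) ≡ 0ℤ
  Pₗ≡0 = trans (cong (λ m → (slice (suc c) (h m) ⋆ slice 0 (e (suc a))) x) (ℕP.n∸n≡0 a))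
               (⋆-zeroˡ (slice 0 (e (suc a))) (slice-suc-h-zero c) x)
  R∘suc≡P : ∀ j → j ℕ.≤ a → R (suc j) ≡ P j
  R∘suc≡P j j≤a = ⋆-cong
    (λ y → trans (sym (slice-suc-h c (a ∸ j) y))
                 (cong (λ m → slice (suc c) (h m) y) (sym (ℕP.+-∸-assoc 1 j≤a))))
    (λ y → trans (slice-one-e-suc j y) (sym (slice-zero-homog κₑ refl j y))) x

h-suc-expansion : ∀ a → h (suc a) ≗ (λ x → ∑[ i ≤ a ] (signPow i * (h (a ∸ i) ⋆ e (suc i)) x))
h-suc-expansion a x = ℤP.i-j≡0⇒i≡j (h (suc a) x) V (begin
  h (suc a) x + - V
    ≡⟨ cong₂ _+_ h≡h⋆e₀ (neg-distrib-∑≤ a _) ⟩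
  1ℤ * (h (suc a) ⋆ e 0) x + ∑[ i ≤ a ] (- (signPow i * (h (a ∸ i) ⋆ e (suc i)) x))
    ≡⟨ cong (1ℤ * (h (suc a) ⋆ e 0) x +_) (∑≤-cong a (λ i → ℤP.neg-distribˡ-* (signPow i) _)) ⟩
  ∑[ j ≤ suc a ] (signPow j * (h (suc a ∸ j) ⋆ e j) x)
    ≡⟨ h⋆e-alternating (suc a) x ⟩
  0ℤ * oneSF x
    ≡⟨ ℤP.*-zeroˡ (oneSF x) ⟩
  0ℤ ∎)
  where
  open ≡-Reasoning
  V : ℤ
  V = ∑[ i ≤ a ] (signPow i * (h (a ∸ i) ⋆ e (suc i)) x)
  h≡h⋆e₀ : h (suc a) x ≡ 1ℤ * (h (suc a) ⋆ e 0) x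
  h≡h⋆e₀ = sym (trans (ℤP.*-identityˡ _)
    (trans (⋆-congʳ (h (suc a)) (homog-zero κₑ refl) x) (⋆-identityʳ (h (suc a)) x)))

-- Coefficients of ω F in terms of coefficients of F

-- ωStep fuel a F β = ∑_γ (-1)^(a - ℓ γ) F (γ ʳ++ β) over the compositions γ of a, mirroring
-- e_a = ∑_γ (-1)^(a - ℓ γ) h_γ; the fuel (any bound ≥ a) only serves termination.
ωStep : ℕ → ℕ → SF → SF
ωStep zero       a       F   = F
ωStep (suc fuel) zero    F   = F
ωStep (suc fuel) (suc a) F β = ∑[ i ≤ a ] (signPow i * ωStep fuel (a ∸ i) F (suc i ∷ β))

ωcoeff : List ℕ → SF → ℤ
ωcoeff []      F = F []
ωcoeff (a ∷ α) F = ωcoeff α (ωStep a a F)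

ωStep-zero : ∀ fuel F → ωStep fuel 0 F ≗ F
ωStep-zero zero       F β = refl
ωStep-zero (suc fuel) F β = refl

ωStep-cong : ∀ fuel a {F G} → F ≗ G → ωStep fuel a F ≗ ωStep fuel a G
ωStep-cong zero       a       F≗G   = F≗G
ωStep-cong (suc fuel) zero    F≗G   = F≗G
ωStep-cong (suc fuel) (suc a) F≗G β =
  ∑≤-cong a (λ i → cong (signPow i *_) (ωStep-cong fuel (a ∸ i) F≗G (suc i ∷ β)))

ωStep-⊕ : ∀ fuel a F G → ωStep fuel a (F ⊕ G) ≗ ωStep fuel a F ⊕ ωStep fuel a G
ωStep-⊕ zero       a       F G β = refl
ωStep-⊕ (suc fuel) zero    F G β = refl
ωStep-⊕ (suc fuel) (suc a) F G β = trans
  (∑≤-cong a (λ i → trans (cong (signPow i *_) (ωStep-⊕ fuel (a ∸ i) F G (suc i ∷ β)))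
                          (ℤP.*-distribˡ-+ (signPow i) _ _)))
  (∑≤-distrib-+ a _ _)

ωStep-· : ∀ fuel a z F → ωStep fuel a (z · F) ≗ z · ωStep fuel a F
ωStep-· zero       a       z F β = refl
ωStep-· (suc fuel) zero    z F β = refl
ωStep-· (suc fuel) (suc a) z F β = trans
  (∑≤-cong a (λ i → trans (cong (signPow i *_) (ωStep-· fuel (a ∸ i) z F (suc i ∷ β)))
                          (x∙yz≈y∙xz (signPow i) z (ωStep fuel (a ∸ i) F (suc i ∷ β)))))
  (sym (*-distribˡ-∑≤ a z _))

ωcoeff-cong : ∀ α {F G} → F ≗ G → ωcoeff α F ≡ ωcoeff α G
ωcoeff-cong []      F≗G = F≗G []
ωcoeff-cong (a ∷ α) F≗G = ωcoeff-cong α (ωStep-cong a a F≗G)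

ωcoeff-⊕ : ∀ α F G → ωcoeff α (F ⊕ G) ≡ ωcoeff α F + ωcoeff α G
ωcoeff-⊕ []      F G = refl
ωcoeff-⊕ (a ∷ α) F G = trans (ωcoeff-cong α (ωStep-⊕ a a F G)) (ωcoeff-⊕ α (ωStep a a F) (ωStep a a G))

ωcoeff-· : ∀ α z F → ωcoeff α (z · F) ≡ z * ωcoeff α F
ωcoeff-· []      z F = refl
ωcoeff-· (a ∷ α) z F = trans (ωcoeff-cong α (ωStep-· a a z F)) (ωcoeff-· α z (ωStep a a F))

-- 0ℤ · oneSF is definitionally const 0ℤ, since 0ℤ * t computes to 0ℤ.
ωcoeff-zero : ∀ α → ωcoeff α (const 0ℤ) ≡ 0ℤ
ωcoeff-zero α = ωcoeff-· α 0ℤ oneSF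

eᵀ hᵀ : List ℕ → SF
eᵀ β ρ = homogProd κₑ ρ β
hᵀ β ρ = homogProd κₕ ρ β

homogProd-at-[] : ∀ κ κ′ ρ → homogProd κ ρ [] ≡ homogProd κ′ ρ []
homogProd-at-[] κ κ′ []      = refl
homogProd-at-[] κ κ′ (k ∷ ρ) = cong (indicator (k ≡ᵇ 0) *_) (homogProd-at-[] κ κ′ ρ)

-- Through the transpose symmetry, ωStep a acts on w as multiplication by h_a (h-suc-expansion).
ωStep-⋆-eᵀ : ∀ fuel a w μ β → a ℕ.≤ fuel →
  ωStep fuel a (λ β′ → (w ⋆ eᵀ β′) μ) β ≡ ((w ⋆ h a) ⋆ eᵀ β) μ
ωStep-⋆-eᵀ fuel zero w μ β _ = trans (ωStep-zero fuel _ β)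
  (sym (⋆-congˡ (eᵀ β) (λ x → trans (⋆-congʳ w (homog-zero κₕ refl) x) (⋆-identityʳ w x)) μ))
ωStep-⋆-eᵀ (suc fuel) (suc a) w μ β (s≤s a≤fuel) = begin
  ∑[ i ≤ a ] (signPow i * ωStep fuel (a ∸ i) (λ β′ → (w ⋆ eᵀ β′) μ) (suc i ∷ β))
    ≡⟨ ∑≤-cong a (λ i → cong (signPow i *_)
         (ωStep-⋆-eᵀ fuel (a ∸ i) w μ (suc i ∷ β) (ℕP.≤-trans (ℕP.m∸n≤m a i) a≤fuel))) ⟩
  ∑[ i ≤ a ] (signPow i * ((w ⋆ h (a ∸ i)) ⋆ eᵀ (suc i ∷ β)) μ)
    ≡⟨ ∑≤-cong a (λ i → cong (signPow i *_) (reassociate i)) ⟩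
  ∑[ i ≤ a ] (signPow i * ((w ⋆ (h (a ∸ i) ⋆ e (suc i))) ⋆ eᵀ β) μ)
    ≡⟨ ∑≤-cong a (λ i → ⋆-scalarˡ (signPow i) (w ⋆ (h (a ∸ i) ⋆ e (suc i))) (eᵀ β) μ) ⟨
  ∑[ i ≤ a ] ((signPow i · (w ⋆ (h (a ∸ i) ⋆ e (suc i)))) ⋆ eᵀ β) μ
    ≡⟨ ⋆-∑ˡ a (λ i → signPow i · (w ⋆ (h (a ∸ i) ⋆ e (suc i)))) (eᵀ β) μ ⟨
  ((λ x → ∑[ i ≤ a ] (signPow i * (w ⋆ (h (a ∸ i) ⋆ e (suc i))) x)) ⋆ eᵀ β) μ
    ≡⟨ ⋆-congˡ (eᵀ β) pull-w μ ⟩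
  ((w ⋆ h (suc a)) ⋆ eᵀ β) μ ∎
  where
  open ≡-Reasoning
  reassociate : ∀ i →
    ((w ⋆ h (a ∸ i)) ⋆ eᵀ (suc i ∷ β)) μ ≡ ((w ⋆ (h (a ∸ i) ⋆ e (suc i))) ⋆ eᵀ β) μ
  reassociate i = begin
    ((w ⋆ h (a ∸ i)) ⋆ eᵀ (suc i ∷ β)) μ
      ≡⟨ ⋆-congʳ (w ⋆ h (a ∸ i)) (λ ρ → homogProd-transpose κₑ ρ (suc i) β) μ ⟩
    ((w ⋆ h (a ∸ i)) ⋆ (e (suc i) ⋆ eᵀ β)) μ
      ≡⟨ ⋆-assoc (w ⋆ h (a ∸ i)) (e (suc i)) (eᵀ β) μ ⟨
    (((w ⋆ h (a ∸ i)) ⋆ e (suc i)) ⋆ eᵀ β) μ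
      ≡⟨ ⋆-congˡ (eᵀ β) (⋆-assoc w (h (a ∸ i)) (e (suc i))) μ ⟩
    ((w ⋆ (h (a ∸ i) ⋆ e (suc i))) ⋆ eᵀ β) μ ∎
  pull-w : (λ x → ∑[ i ≤ a ] (signPow i * (w ⋆ (h (a ∸ i) ⋆ e (suc i))) x)) ≗ w ⋆ h (suc a)
  pull-w x = begin
    ∑[ i ≤ a ] (signPow i * (w ⋆ (h (a ∸ i) ⋆ e (suc i))) x)
      ≡⟨ ∑≤-cong a (λ i → ⋆-scalarʳ (signPow i) w (h (a ∸ i) ⋆ e (suc i)) x) ⟨
    ∑[ i ≤ a ] (w ⋆ (signPow i · (h (a ∸ i) ⋆ e (suc i)))) x
      ≡⟨ ⋆-∑ʳ a w (λ i → signPow i · (h (a ∸ i) ⋆ e (suc i))) x ⟨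
    (w ⋆ (λ y → ∑[ i ≤ a ] (signPow i * (h (a ∸ i) ⋆ e (suc i)) y))) x
      ≡⟨ ⋆-congʳ w (h-suc-expansion a) x ⟨
    (w ⋆ h (suc a)) x ∎

ωcoeff-⋆-eᵀ : ∀ α w μ → ωcoeff α (λ β → (w ⋆ eᵀ β) μ) ≡ (w ⋆ hᵀ α) μ
ωcoeff-⋆-eᵀ []      w μ = ⋆-congʳ w (λ ρ → homogProd-at-[] κₑ κₕ ρ) μ
ωcoeff-⋆-eᵀ (a ∷ α) w μ = begin
  ωcoeff α (ωStep a a (λ β → (w ⋆ eᵀ β) μ))
    ≡⟨ ωcoeff-cong α (λ β → ωStep-⋆-eᵀ a a w μ β ℕP.≤-refl) ⟩
  ωcoeff α (λ β → ((w ⋆ h a) ⋆ eᵀ β) μ)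
    ≡⟨ ωcoeff-⋆-eᵀ α (w ⋆ h a) μ ⟩
  ((w ⋆ h a) ⋆ hᵀ α) μ
    ≡⟨ ⋆-assoc w (h a) (hᵀ α) μ ⟩
  (w ⋆ (h a ⋆ hᵀ α)) μ
    ≡⟨ ⋆-congʳ w (λ ρ → homogProd-transpose κₕ ρ a α) μ ⟨
  (w ⋆ hᵀ (a ∷ α)) μ ∎
  where open ≡-Reasoning

ωcoeff-eProd : ∀ μ α → ωcoeff α (eProd μ) ≡ hProd μ α
ωcoeff-eProd μ α = begin
  ωcoeff α (eProd μ)
    ≡⟨ ωcoeff-cong α (λ β → trans (eProd≗homogProd μ β) (sym (⋆-identityˡ (eᵀ β) μ))) ⟩
  ωcoeff α (λ β → (oneSF ⋆ eᵀ β) μ)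
    ≡⟨ ωcoeff-⋆-eᵀ α oneSF μ ⟩
  (oneSF ⋆ hᵀ α) μ
    ≡⟨ ⋆-identityˡ (hᵀ α) μ ⟩
  homogProd κₕ μ α
    ≡⟨ hProd≗homogProd μ α ⟨
  hProd μ α ∎
  where open ≡-Reasoning

combH≡ωcoeff-combE : ∀ c α → combH c α ≡ ωcoeff α (combE c)
combH≡ωcoeff-combE []            α = sym (ωcoeff-zero α)
combH≡ωcoeff-combE ((z , μ) ∷ c) α = sym (begin
  ωcoeff α (z · eProd μ ⊕ combE c)
    ≡⟨ ωcoeff-⊕ α (z · eProd μ) (combE c) ⟩
  ωcoeff α (z · eProd μ) + ωcoeff α (combE c)
    ≡⟨ cong₂ _+_ (ωcoeff-· α z (eProd μ)) (sym (combH≡ωcoeff-combE c α)) ⟩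
  z * ωcoeff α (eProd μ) + combH c α
    ≡⟨ cong (λ t → z * t + combH c α) (ωcoeff-eProd μ α) ⟩
  z * hProd μ α + combH c α ∎)
  where open ≡-Reasoning

nonzeros : List ℕ → List ℕ
nonzeros = filter (λ a → ¬? (a ℕ.≟ 0))

sort-≡⇒↭ : ∀ xs ys → sort xs ≡ sort ys → xs ↭ ys
sort-≡⇒↭ xs ys eq = ↭-trans (↭-sym (sort-↭ xs)) (subst (_↭ ys) (sym eq) (sort-↭ ys))

↭-replicate-1 : ∀ {xs} n → xs ↭ replicate n 1 → xs ≡ replicate n 1
↭-replicate-1 {xs} n xs↭1ⁿ = trans (all-1 (PermP.All-resp-↭ (↭-sym xs↭1ⁿ) (AllP.replicate⁺ n refl)))
  (cong (λ k → replicate k 1) (trans (PermP.↭-length xs↭1ⁿ) (LP.length-replicate n)))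
  where
  all-1 : ∀ {ys} → All (_≡ 1) ys → ys ≡ replicate (length ys) 1
  all-1 []           = refl
  all-1 (refl ∷ ys≡1) = cong (1 ∷_) (all-1 ys≡1)

monoSF-cases : ∀ la x → monoSF la x ≡ 0ℤ ⊎ (monoSF la x ≡ 1ℤ × length (nonzeros x) ≡ length la)
monoSF-cases la x with ≡-dec ℕ._≟_ (sort (nonzeros x)) (sort la)
... | yes eq = inj₂ (refl , PermP.↭-length (sort-≡⇒↭ (nonzeros x) la eq))
... | no _   = inj₁ refl

monoSF-self≢0 : ∀ la → All (0 ℕ.<_) la → monoSF la la ≢ 0ℤ
monoSF-self≢0 la pos with ≡-dec ℕ._≟_ (sort (nonzeros la)) (sort la)
... | yes _ = λ ()
... | no ne =
  ⊥-elim (ne (cong sort (LP.filter-all (λ a → ¬? (a ℕ.≟ 0)) (All.map (λ 0<a → ℕP.<⇒≢ 0<a ∘ sym) pos))))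

nonzeros-replicate-1 : ∀ n → nonzeros (replicate n 1) ≡ replicate n 1
nonzeros-replicate-1 zero    = refl
nonzeros-replicate-1 (suc n) = cong (1 ∷_) (nonzeros-replicate-1 n)

monoSF-at-1ⁿ : ∀ la n → la ≢ replicate n 1 → monoSF la (replicate n 1) ≡ 0ℤ
monoSF-at-1ⁿ la n la≢1ⁿ with ≡-dec ℕ._≟_ (sort (nonzeros (replicate n 1))) (sort la)
... | yes eq = ⊥-elim (la≢1ⁿ (↭-replicate-1 n
                 (sort-≡⇒↭ la (replicate n 1) (trans (sym eq) (cong sort (nonzeros-replicate-1 n))))))
... | no _   = refl

e-at-1ⁿ : ∀ n β → nonzeros β ≡ replicate n 1 → e n β ≡ 1ℤ
e-at-1ⁿ zero    []              eq = refl
e-at-1ⁿ n       (zero ∷ β)      eq = trans (ℤP.*-identityˡ _) (e-at-1ⁿ n β eq)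
e-at-1ⁿ (suc n) (suc zero ∷ β)  eq = trans (ℤP.*-identityˡ _) (e-at-1ⁿ n β (LP.∷-injectiveʳ eq))
e-at-1ⁿ (suc n) (suc (suc b) ∷ β) eq with () ← LP.∷-injectiveˡ eq

e≢0⇒nonzeros≡1ⁿ : ∀ n β → e n β ≢ 0ℤ → nonzeros β ≡ replicate n 1
e≢0⇒nonzeros≡1ⁿ zero    []                  e≢0 = refl
e≢0⇒nonzeros≡1ⁿ (suc n) []                  e≢0 = ⊥-elim (e≢0 refl)
e≢0⇒nonzeros≡1ⁿ n       (zero ∷ β)          e≢0 = e≢0⇒nonzeros≡1ⁿ n β (e≢0 ∘ trans (ℤP.*-identityˡ _))
e≢0⇒nonzeros≡1ⁿ zero    (suc zero ∷ β)      e≢0 = ⊥-elim (e≢0 (ℤP.*-zeroˡ (e 0 β)))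
e≢0⇒nonzeros≡1ⁿ (suc n) (suc zero ∷ β)      e≢0 =
  cong (1 ∷_) (e≢0⇒nonzeros≡1ⁿ n β (e≢0 ∘ trans (ℤP.*-identityˡ _)))
e≢0⇒nonzeros≡1ⁿ n       (suc (suc b) ∷ β)   e≢0 = ⊥-elim (e≢0 (slice-suc-suc-e b n β))

monoSF-1ⁿ : ∀ n → monoSF (replicate n 1) ≗ e n
monoSF-1ⁿ n β with ≡-dec ℕ._≟_ (sort (nonzeros β)) (sort (replicate n 1))
... | yes eq = sym (e-at-1ⁿ n β (↭-replicate-1 n (sort-≡⇒↭ (nonzeros β) (replicate n 1) eq)))
... | no ne with e n β ℤ.≟ 0ℤ
...   | yes e≡0 = sym e≡0
...   | no  e≢0 = ⊥-elim (ne (cong sort (e≢0⇒nonzeros≡1ⁿ n β e≢0)))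

-- Sign coherence of the coefficients of ω m_λ

signPow-+ : ∀ x y → signPow (x ℕ.+ y) ≡ signPow x * signPow y
signPow-+ zero    y = sym (ℤP.*-identityˡ _)
signPow-+ (suc x) y = trans (cong -_ (signPow-+ x y)) (ℤP.neg-distribˡ-* (signPow x) (signPow y))

∣signPow∣ : ∀ k → ℤ.∣ signPow k ∣ ≡ 1
∣signPow∣ zero    = refl
∣signPow∣ (suc k) = trans (ℤP.∣-i∣≡∣i∣ (signPow k)) (∣signPow∣ k)

signPow-double : ∀ x → signPow (x ℕ.+ x) ≡ 1ℤ
signPow-double zero    = refl
signPow-double (suc x) = trans (cong (-_ ∘ signPow) (ℕP.+-suc x x)) (trans (ℤP.neg-involutive _) (signPow-double x))

signPow≢0 : ∀ k → signPow k ≢ 0ℤ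
signPow≢0 k eq with () ← trans (sym (∣signPow∣ k)) (cong ℤ.∣_∣ eq)

*-≢0 : ∀ {x y} → x ≢ 0ℤ → y ≢ 0ℤ → x * y ≢ 0ℤ
*-≢0 {x} x≢0 y≢0 xy≡0 = [ x≢0 , y≢0 ]′ (ℤP.i*j≡0⇒i≡0∨j≡0 x xy≡0)

signed-≢0⇒1≤ : ∀ {z} k N → z ≡ signPow k * ℤ.+ N → z ≢ 0ℤ → 1 ℕ.≤ N
signed-≢0⇒1≤ k zero    z≡ z≢0 = ⊥-elim (z≢0 (trans z≡ (ℤP.*-zeroʳ (signPow k))))
signed-≢0⇒1≤ k (suc N) _  _   = s≤s z≤n

ℓ⁺ : List ℕ → ℕ
ℓ⁺ x = length (nonzeros x)

SignCoherent : ℕ → SF → Set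
SignCoherent l F = ∀ x → Σ ℕ λ N → F x ≡ signPow (ℓ⁺ x ℕ.+ l) * ℤ.+ N

monoSF-signCoherent : ∀ la → SignCoherent (length la) (monoSF la)
monoSF-signCoherent la x with monoSF-cases la x
... | inj₁ m≡0         = 0 , trans m≡0 (sym (ℤP.*-zeroʳ (signPow (ℓ⁺ x ℕ.+ length la))))
... | inj₂ (m≡1 , ℓ≡l) = 1 , trans m≡1 (sym (trans (ℤP.*-identityʳ _)
                               (trans (cong (λ k → signPow (k ℕ.+ length la)) ℓ≡l) (signPow-double (length la)))))

∑≤ℕ : ℕ → (ℕ → ℕ) → ℕ
∑≤ℕ zero    g = g 0
∑≤ℕ (suc a) g = g 0 ℕ.+ ∑≤ℕ a (g ∘ suc)

∑≤-pos : ∀ a (g : ℕ → ℕ) → ∑[ i ≤ a ] (ℤ.+ g i) ≡ ℤ.+ ∑≤ℕ a g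
∑≤-pos zero    g = refl
∑≤-pos (suc a) g = trans (cong (ℤ.+ g 0 +_) (∑≤-pos a (g ∘ suc))) (sym (ℤP.pos-+ (g 0) _))

≤-∑≤ℕ : ∀ a (g : ℕ → ℕ) i → i ℕ.≤ a → g i ℕ.≤ ∑≤ℕ a g
≤-∑≤ℕ zero    g zero    _         = ℕP.≤-refl
≤-∑≤ℕ (suc a) g zero    _         = ℕP.m≤m+n (g 0) _
≤-∑≤ℕ (suc a) g (suc i) (s≤s i≤a) = ℕP.≤-trans (≤-∑≤ℕ a (g ∘ suc) i i≤a) (ℕP.m≤n+m _ (g 0))

IsComposition : ℕ → List ℕ → Set
IsComposition a γ = All (0 ℕ.<_) γ × sumℕ γ ≡ a

IsComposition-uncons : ∀ {a i γ} → IsComposition (suc a) (suc i ∷ γ) → i ℕ.≤ a × IsComposition (a ∸ i) γ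
IsComposition-uncons {a} {i} {γ} (_ ∷ pos , Σ≡) = i≤a , pos , Σγ≡a∸i
  where
  i+Σγ≡a : i ℕ.+ sumℕ γ ≡ a
  i+Σγ≡a = ℕP.suc-injective Σ≡
  i≤a : i ℕ.≤ a
  i≤a = subst (i ℕ.≤_) i+Σγ≡a (ℕP.m≤m+n i (sumℕ γ))
  Σγ≡a∸i : sumℕ γ ≡ a ∸ i
  Σγ≡a∸i = trans (sym (ℕP.m+n∸m≡n i (sumℕ γ))) (cong (_∸ i) i+Σγ≡a)

signPow-split : ∀ {i a} g → i ℕ.≤ a → signPow i * signPow (a ∸ i ℕ.+ suc g) ≡ signPow (suc a ℕ.+ g)
signPow-split {i} {a} g i≤a = begin
  signPow i * signPow (a ∸ i ℕ.+ suc g)  ≡⟨ signPow-+ i _ ⟨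
  signPow (i ℕ.+ (a ∸ i ℕ.+ suc g))      ≡⟨ cong signPow (ℕP.+-assoc i (a ∸ i) (suc g)) ⟨
  signPow (i ℕ.+ (a ∸ i) ℕ.+ suc g)      ≡⟨ cong (λ k → signPow (k ℕ.+ suc g)) (ℕP.m+[n∸m]≡n i≤a) ⟩
  signPow (a ℕ.+ suc g)                  ≡⟨ cong signPow (ℕP.+-suc a g) ⟩
  signPow (suc a ℕ.+ g)                  ∎
  where open ≡-Reasoning

ωStep-signCoherent : ∀ {l F} → SignCoherent l F → ∀ fuel a β → a ℕ.≤ fuel →
  Σ ℕ λ N → ωStep fuel a F β ≡ signPow (a ℕ.+ (ℓ⁺ β ℕ.+ l)) * ℤ.+ N
          × (∀ γ → IsComposition a γ → F (γ ʳ++ β) ≢ 0ℤ → 1 ℕ.≤ N)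
ωStep-signCoherent {l} {F} coh fuel zero β _ with coh β
... | N , F≡ = N , trans (ωStep-zero fuel F β) F≡ , bound
  where
  bound : ∀ γ → IsComposition 0 γ → F (γ ʳ++ β) ≢ 0ℤ → 1 ℕ.≤ N
  bound []          _            F≢0 = signed-≢0⇒1≤ (ℓ⁺ β ℕ.+ l) N F≡ F≢0
  bound (zero ∷ _)  (() ∷ _ , _)
  bound (suc _ ∷ _) (_ , ())
ωStep-signCoherent {l} {F} coh (suc fuel) (suc a) β (s≤s a≤fuel) =
  N , trans (∑≤-cong-≤ a sign-aligned) (trans (sym (*-distribˡ-∑≤ a s _)) (cong (s *_) (∑≤-pos a Nᵢ))) , bound
  where
  IH : ∀ i → Σ ℕ λ M → ωStep fuel (a ∸ i) F (suc i ∷ β) ≡ signPow (a ∸ i ℕ.+ suc (ℓ⁺ β ℕ.+ l)) * ℤ.+ M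
                     × (∀ γ → IsComposition (a ∸ i) γ → F (γ ʳ++ (suc i ∷ β)) ≢ 0ℤ → 1 ℕ.≤ M)
  IH i = ωStep-signCoherent coh fuel (a ∸ i) (suc i ∷ β) (ℕP.≤-trans (ℕP.m∸n≤m a i) a≤fuel)
  Nᵢ : ℕ → ℕ
  Nᵢ i = proj₁ (IH i)
  N : ℕ
  N = ∑≤ℕ a Nᵢ
  s : ℤ
  s = signPow (suc a ℕ.+ (ℓ⁺ β ℕ.+ l))
  sign-aligned : ∀ i → i ℕ.≤ a → signPow i * ωStep fuel (a ∸ i) F (suc i ∷ β) ≡ s * ℤ.+ Nᵢ i
  sign-aligned i i≤a = begin
    signPow i * ωStep fuel (a ∸ i) F (suc i ∷ β)
      ≡⟨ cong (signPow i *_) (proj₁ (proj₂ (IH i))) ⟩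
    signPow i * (signPow (a ∸ i ℕ.+ suc (ℓ⁺ β ℕ.+ l)) * ℤ.+ Nᵢ i)
      ≡⟨ ℤP.*-assoc (signPow i) _ _ ⟨
    signPow i * signPow (a ∸ i ℕ.+ suc (ℓ⁺ β ℕ.+ l)) * ℤ.+ Nᵢ i
      ≡⟨ cong (_* ℤ.+ Nᵢ i) (signPow-split (ℓ⁺ β ℕ.+ l) i≤a) ⟩
    s * ℤ.+ Nᵢ i ∎
    where open ≡-Reasoning
  bound : ∀ γ → IsComposition (suc a) γ → F (γ ʳ++ β) ≢ 0ℤ → 1 ℕ.≤ N
  bound []          (_ , ())
  bound (zero ∷ _)  (() ∷ _ , _)
  bound (suc i ∷ γ) comp F≢0 with IsComposition-uncons comp
  ... | i≤a , comp′ = ℕP.≤-trans (proj₂ (proj₂ (IH i)) γ comp′ F≢0) (≤-∑≤ℕ a Nᵢ i i≤a)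

ωStep-monoSF≢0 : ∀ n la → IsComposition n la → ωStep n n (monoSF la) [] ≢ 0ℤ
ωStep-monoSF≢0 n la (pos , Σla≡n) with ωStep-signCoherent (monoSF-signCoherent la) n n [] ℕP.≤-refl
... | suc N , ωStep≡ , _     = *-≢0 (signPow≢0 (n ℕ.+ length la)) (λ ()) ∘ trans (sym ωStep≡)
... | zero  , _      , bound = contradiction (bound (reverse la) reverse-la la≢0) λ ()
  where
  reverse-la : IsComposition n (reverse la)
  reverse-la = PermP.All-resp-↭ (↭-sym (PermP.↭-reverse la)) pos , trans (sum-↭ (PermP.↭-reverse la)) Σla≡n
  la≢0 : monoSF la (reverse la ʳ++ []) ≢ 0ℤ
  la≢0 = monoSF-self≢0 la pos ∘ trans (cong (monoSF la) (sym reverse-la-ʳ++-[]))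
    where
    reverse-la-ʳ++-[] : reverse la ʳ++ [] ≡ la
    reverse-la-ʳ++-[] =
      trans (LP.ʳ++-defn (reverse la)) (trans (LP.++-identityʳ _) (LP.reverse-involutive la))

-- Newton polytopes

module ℚΣ = SemiringSum (CommutativeRing.semiring ℚP.+-*-commutativeRing)

coprime-1 : ∀ a → Coprime a 1
coprime-1 a = Coprimality.sym (Coprimality.1-coprimeTo a)

toℚ-mkℚ : ∀ a → toℚ a ≡ mkℚ (ℤ.+ a) 0 (coprime-1 a)
toℚ-mkℚ a = ℚP.normalize-coprime (coprime-1 a)

toℚ-+ : ∀ a b → toℚ (a ℕ.+ b) ≡ toℚ a ℚ.+ toℚ b
toℚ-+ a b = begin
  toℚ (a ℕ.+ b)
    ≡⟨ toℚ-mkℚ (a ℕ.+ b) ⟩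
  mkℚ (ℤ.+ (a ℕ.+ b)) 0 (coprime-1 (a ℕ.+ b))
    ≡⟨ ℚP.toℚᵘ-injective (ℚᵘP.≃-sym (ℚᵘP.≃-trans (ℚP.toℚᵘ-homo-+ p q) (ℚᵘ.*≡* cross))) ⟩
  p ℚ.+ q
    ≡⟨ cong₂ ℚ._+_ (toℚ-mkℚ a) (toℚ-mkℚ b) ⟨
  toℚ a ℚ.+ toℚ b ∎
  where
  open ≡-Reasoning
  p q : ℚ
  p = mkℚ (ℤ.+ a) 0 (coprime-1 a)
  q = mkℚ (ℤ.+ b) 0 (coprime-1 b)
  cross : (ℤ.+ a * 1ℤ + ℤ.+ b * 1ℤ) * 1ℤ ≡ ℤ.+ (a ℕ.+ b) * (1ℤ * 1ℤ)
  cross = cong (_* 1ℤ)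
    (trans (cong₂ _+_ (ℤP.*-identityʳ (ℤ.+ a)) (ℤP.*-identityʳ (ℤ.+ b))) (sym (ℤP.pos-+ a b)))

1/[1+_] : ℕ → ℚ
1/[1+ n ] = 1/ mkℚ (ℤ.+ suc n) 0 (coprime-1 (suc n))

toℚ-*-1/[1+] : ∀ n → toℚ (suc n) ℚ.* 1/[1+ n ] ≡ 1ℚ
toℚ-*-1/[1+] n =
  trans (cong (ℚ._* 1/[1+ n ]) (toℚ-mkℚ (suc n))) (ℚP.*-inverseʳ (mkℚ (ℤ.+ suc n) 0 (coprime-1 (suc n))))

toℚ-injective : ∀ {a b} → toℚ a ≡ toℚ b → a ≡ b
toℚ-injective {a} {b} eq = ℤP.+-injective (cong ℚ.↥_ (trans (sym (toℚ-mkℚ a)) (trans eq (toℚ-mkℚ b))))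

sum-toℚ : ∀ {m} (v : Vec ℕ m) → toℚ (sumℕ (Vec.toList v)) ≡ ℚΣ.sum (λ i → toℚ (Vec.lookup v i))
sum-toℚ Vec.[]       = refl
sum-toℚ (x Vec.∷ v) = trans (toℚ-+ x _) (cong (toℚ x ℚ.+_) (sum-toℚ v))

sumℚ-tabulate : ∀ {m} (f : Fin m → ℚ) → sumℚ (tabulate f) ≡ ℚΣ.sum f
sumℚ-tabulate {zero}  f = refl
sumℚ-tabulate {suc m} f = cong (f Fin.zero ℚ.+_) (sumℚ-tabulate (f ∘ Fin.suc))

ℚΣ-sumℚ-comm : ∀ {m} {X : Set} (φ : Fin m → X → ℚ) (ps : List X) →
  ℚΣ.sum (λ i → sumℚ (map (φ i) ps)) ≡ sumℚ (map (λ p → ℚΣ.sum (λ i → φ i p)) ps)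
ℚΣ-sumℚ-comm {m} φ []       = ℚΣ.sum-replicate-zero m
ℚΣ-sumℚ-comm     φ (p ∷ ps) =
  trans (ℚΣ.∑-distrib-+ (λ i → φ i p) (λ i → sumℚ (map (φ i) ps)))
        (cong (ℚΣ.sum (λ i → φ i p) ℚ.+_) (ℚΣ-sumℚ-comm φ ps))

sumℚ-map-*ʳ : ∀ {X : Set} (f : X → ℚ) c (ps : List X) →
  sumℚ (map (λ p → f p ℚ.* c) ps) ≡ sumℚ (map f ps) ℚ.* c
sumℚ-map-*ʳ f c []       = sym (ℚP.*-zeroˡ c)
sumℚ-map-*ʳ f c (p ∷ ps) = trans (cong (f p ℚ.* c ℚ.+_) (sumℚ-map-*ʳ f c ps)) (sym (ℚP.*-distribʳ-+ c (f p) _))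

InNewtonPolytope⇒degree : ∀ {m} (g : Poly m) n → (∀ α → g α ≢ 0ℤ → sumℕ (Vec.toList α) ≡ n) →
  ∀ β → InNewtonPolytope g β → sumℕ (Vec.toList β) ≡ n
InNewtonPolytope⇒degree {m} g n homogeneous β (pts , support , Σt≡1 , barycentre) = toℚ-injective (begin
  toℚ (sumℕ (Vec.toList β))                    ≡⟨ sum-toℚ β ⟩
  ℚΣ.sum (λ i → toℚ (Vec.lookup β i))          ≡⟨ ℚΣ.sum-cong-≗ (sym ∘ barycentre) ⟩
  ℚΣ.sum (λ i → sumℚ (map (φ i) pts))          ≡⟨ ℚΣ-sumℚ-comm φ pts ⟩
  sumℚ (map (λ p → ℚΣ.sum (λ i → φ i p)) pts)
    ≡⟨ cong sumℚ (LP.map-cong-local (All.map point-degree support)) ⟩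
  sumℚ (map (λ p → proj₁ p ℚ.* toℚ n) pts)     ≡⟨ sumℚ-map-*ʳ proj₁ (toℚ n) pts ⟩
  sumℚ (map proj₁ pts) ℚ.* toℚ n               ≡⟨ cong (ℚ._* toℚ n) Σt≡1 ⟩
  1ℚ ℚ.* toℚ n                                 ≡⟨ ℚP.*-identityˡ (toℚ n) ⟩
  toℚ n                                        ∎)
  where
  open ≡-Reasoning
  φ : Fin m → ℚ × Vec ℕ m → ℚ
  φ i (t , α) = t ℚ.* toℚ (Vec.lookup α i)
  point-degree : ∀ {p} → (0ℚ ℚ.≤ proj₁ p) × (g (proj₂ p) ≢ 0ℤ) →
                 ℚΣ.sum (λ i → φ i p) ≡ proj₁ p ℚ.* toℚ n
  point-degree {t , α} (_ , gα≢0) = begin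
    ℚΣ.sum (λ i → t ℚ.* toℚ (Vec.lookup α i))  ≡⟨ ℚΣ.*-distribˡ-sum t (λ i → toℚ (Vec.lookup α i)) ⟨
    t ℚ.* ℚΣ.sum (λ i → toℚ (Vec.lookup α i))  ≡⟨ cong (t ℚ.*_) (sum-toℚ α) ⟨
    t ℚ.* toℚ (sumℕ (Vec.toList α))            ≡⟨ cong (λ k → t ℚ.* toℚ k) (homogeneous α gα≢0) ⟩
    t ℚ.* toℚ n                                ∎

indicator≢0⇒T : ∀ {b} → indicator b ≢ 0ℤ → T b
indicator≢0⇒T {true}  _  = _
indicator≢0⇒T {false} ne = ne refl

hSF≢0⇒degree : ∀ n α → hSF n α ≢ 0ℤ → sumℕ α ≡ n
hSF≢0⇒degree n α = ℕP.≡ᵇ⇒≡ (sumℕ α) n ∘ indicator≢0⇒T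

hSF-degree≢0 : ∀ α → hSF (sumℕ α) α ≢ 0ℤ
hSF-degree≢0 α with sumℕ α ≡ᵇ sumℕ α | ℕP.≡⇒≡ᵇ (sumℕ α) (sumℕ α) refl
... | true | _ = λ ()

≗hSF⇒SNP : ∀ {F} n → F ≗ hSF n → SNP F
≗hSF⇒SNP {F} n F≗h m _ β β∈P Fβ≡0 = hSF-degree≢0 (Vec.toList β) (begin
  hSF (sumℕ (Vec.toList β)) (Vec.toList β) ≡⟨ cong (λ k → hSF k (Vec.toList β)) degree ⟩
  hSF n (Vec.toList β)                     ≡⟨ F≗h (Vec.toList β) ⟨
  F (Vec.toList β)                         ≡⟨ Fβ≡0 ⟩
  0ℤ                                       ∎)
  where
  open ≡-Reasoning
  degree : sumℕ (Vec.toList β) ≡ n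
  degree = InNewtonPolytope⇒degree (restrict m F) n
    (λ α Fα≢0 → hSF≢0⇒degree n (Vec.toList α) (Fα≢0 ∘ trans (F≗h (Vec.toList α)))) β β∈P

scaledUnit : ∀ {m} → Fin m → ℕ → Vec ℕ m
scaledUnit i x = Vec.replicate _ 0 Vec.[ i ]≔ x

ℚΣ-const : ∀ k w → ℚΣ.sum {k} (λ _ → w) ≡ toℚ k ℚ.* w
ℚΣ-const zero    w = sym (ℚP.*-zeroˡ w)
ℚΣ-const (suc k) w = begin
  w ℚ.+ ℚΣ.sum {k} (λ _ → w)     ≡⟨ cong₂ ℚ._+_ (sym (ℚP.*-identityˡ w)) (ℚΣ-const k w) ⟩
  1ℚ ℚ.* w ℚ.+ toℚ k ℚ.* w       ≡⟨ ℚP.*-distribʳ-+ w 1ℚ (toℚ k) ⟨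
  (1ℚ ℚ.+ toℚ k) ℚ.* w           ≡⟨ cong (ℚ._* w) (toℚ-+ 1 k) ⟨
  toℚ (suc k) ℚ.* w              ∎
  where open ≡-Reasoning

ℚΣ-single : ∀ {k} (f : Fin (suc k) → ℚ) j → (∀ i → i ≢ j → f i ≡ 0ℚ) → ℚΣ.sum f ≡ f j
ℚΣ-single {k} f j off-j = begin
  ℚΣ.sum f                                      ≡⟨ ℚΣ.sum-remove {i = j} f ⟩
  f j ℚ.+ ℚΣ.sum (f ∘ Fin.punchIn j)
    ≡⟨ cong (f j ℚ.+_) (ℚΣ.sum-cong-≗ (λ i → off-j (Fin.punchIn j i) (FinP.punchInᵢ≢i j i))) ⟩
  f j ℚ.+ ℚΣ.sum {k} (λ _ → 0ℚ)                 ≡⟨ cong (f j ℚ.+_) (ℚΣ.sum-replicate-zero k) ⟩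
  f j ℚ.+ 0ℚ                                    ≡⟨ ℚP.+-identityʳ (f j) ⟩
  f j                                           ∎
  where open ≡-Reasoning

1ⁿ∈NewtonPolytope : ∀ n (g : Poly (suc n)) → (∀ i → g (scaledUnit i (suc n)) ≢ 0ℤ) →
  InNewtonPolytope g (Vec.replicate (suc n) 1)
1ⁿ∈NewtonPolytope n g vertices≢0 =
  pts , AllP.tabulate⁺ (λ i → ℚP.nonNegative⁻¹ w , vertices≢0 i) , weights , coordinates
  where
  open ≡-Reasoning
  N : ℕ
  N = suc n
  w : ℚ
  w = 1/[1+ n ]
  pts : List (ℚ × Vec ℕ N)
  pts = tabulate (λ i → w , scaledUnit i N)
  weights : sumℚ (map proj₁ pts) ≡ 1ℚ
  weights = begin
    sumℚ (map proj₁ pts)        ≡⟨ cong sumℚ (LP.map-tabulate {n = N} (λ i → w , scaledUnit i N) proj₁) ⟩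
    sumℚ (tabulate {n = N} (λ _ → w)) ≡⟨ sumℚ-tabulate {N} (λ _ → w) ⟩
    ℚΣ.sum {N} (λ _ → w)        ≡⟨ ℚΣ-const N w ⟩
    toℚ N ℚ.* w                 ≡⟨ toℚ-*-1/[1+] n ⟩
    1ℚ                          ∎
  coordinates : ∀ j →
    sumℚ (map (λ (t , α) → t ℚ.* toℚ (Vec.lookup α j)) pts) ≡ toℚ (Vec.lookup (Vec.replicate N 1) j)
  coordinates j = begin
    sumℚ (map (λ (t , α) → t ℚ.* toℚ (Vec.lookup α j)) pts)
      ≡⟨ cong sumℚ (LP.map-tabulate (λ i → w , scaledUnit i N) (λ (t , α) → t ℚ.* toℚ (Vec.lookup α j))) ⟩
    sumℚ (tabulate (λ i → w ℚ.* toℚ (Vec.lookup (scaledUnit i N) j)))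
      ≡⟨ sumℚ-tabulate (λ i → w ℚ.* toℚ (Vec.lookup (scaledUnit i N) j)) ⟩
    ℚΣ.sum (λ i → w ℚ.* toℚ (Vec.lookup (scaledUnit i N) j))
      ≡⟨ ℚΣ-single (λ i → w ℚ.* toℚ (Vec.lookup (scaledUnit i N) j)) j
           (λ i i≢j → trans (cong (λ k → w ℚ.* toℚ k) (off-diagonal i≢j)) (ℚP.*-zeroʳ w)) ⟩
    w ℚ.* toℚ (Vec.lookup (scaledUnit j N) j)
      ≡⟨ cong (λ k → w ℚ.* toℚ k) (VecP.lookup∘update j (Vec.replicate N 0) N) ⟩
    w ℚ.* toℚ N
      ≡⟨ trans (ℚP.*-comm w (toℚ N)) (toℚ-*-1/[1+] n) ⟩
    1ℚ
      ≡⟨ cong toℚ (VecP.lookup-replicate j 1) ⟨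
    toℚ (Vec.lookup (Vec.replicate N 1) j) ∎
    where
    off-diagonal : ∀ {i} → i ≢ j → Vec.lookup (scaledUnit i N) j ≡ 0
    off-diagonal i≢j = trans (VecP.lookup∘update′ (i≢j ∘ sym) (Vec.replicate N 0) N) (VecP.lookup-replicate j 0)

ωcoeff-1ⁿ : ∀ k F → ωcoeff (replicate k 1) F ≡ F (replicate k 1)
ωcoeff-1ⁿ zero    F = refl
ωcoeff-1ⁿ (suc k) F = trans (ωcoeff-1ⁿ k (ωStep 1 1 F)) (ℤP.*-identityˡ _)

ωcoeff-0ⁿ : ∀ k F → ωcoeff (replicate k 0) F ≡ F []
ωcoeff-0ⁿ zero    F = refl
ωcoeff-0ⁿ (suc k) F = ωcoeff-0ⁿ k F

ωcoeff-scaledUnit : ∀ {m} (i : Fin m) x F → ωcoeff (Vec.toList (scaledUnit i x)) F ≡ ωStep x x F []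
ωcoeff-scaledUnit {suc m} Fin.zero    x F =
  trans (cong (λ zeros → ωcoeff zeros (ωStep x x F)) (VecP.toList-replicate m 0)) (ωcoeff-0ⁿ m (ωStep x x F))
ωcoeff-scaledUnit {suc m} (Fin.suc i) x F = ωcoeff-scaledUnit i x F

forgottenVia-ωcoeff : ∀ la c → (∀ α → monoSF la α ≡ combE c α) →
  ∀ α → forgottenVia la c α ≡ signPow (sumℕ la ∸ length la) * ωcoeff α (monoSF la)
forgottenVia-ωcoeff la c m≡c α =
  cong (signPow (sumℕ la ∸ length la) *_) (trans (combH≡ωcoeff-combE c α) (ωcoeff-cong α (sym ∘ m≡c)))

forgottenVia-1ⁿ : ∀ n c → (∀ α → monoSF (replicate n 1) α ≡ combE c α) →
  forgottenVia (replicate n 1) c ≗ hSF n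
forgottenVia-1ⁿ n c m≡c α = begin
  forgottenVia (replicate n 1) c α
    ≡⟨ forgottenVia-ωcoeff (replicate n 1) c m≡c α ⟩
  signPow (sumℕ (replicate n 1) ∸ length (replicate n 1)) * ωcoeff α (monoSF (replicate n 1))
    ≡⟨ cong₂ _*_ (cong signPow ε≡0) (ωcoeff-cong α m≗eₙ) ⟩
  1ℤ * ωcoeff α (eProd (n ∷ []))  ≡⟨ ℤP.*-identityˡ _ ⟩
  ωcoeff α (eProd (n ∷ []))       ≡⟨ ωcoeff-eProd (n ∷ []) α ⟩
  hProd (n ∷ []) α                ≡⟨ ⊛≗⋆ (hSF n) oneSF α ⟩
  (hSF n ⋆ oneSF) α               ≡⟨ ⋆-identityʳ (hSF n) α ⟩
  hSF n α                         ∎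
  where
  open ≡-Reasoning
  ε≡0 : sumℕ (replicate n 1) ∸ length (replicate n 1) ≡ 0
  ε≡0 = trans (cong₂ _∸_ (sum-replicate-1 n) (LP.length-replicate n)) (ℕP.n∸n≡0 n)
    where
    sum-replicate-1 : ∀ n → sumℕ (replicate n 1) ≡ n
    sum-replicate-1 zero    = refl
    sum-replicate-1 (suc n) = cong suc (sum-replicate-1 n)
  m≗eₙ : monoSF (replicate n 1) ≗ eProd (n ∷ [])
  m≗eₙ x = begin
    monoSF (replicate n 1) x  ≡⟨ monoSF-1ⁿ n x ⟩
    e n x                     ≡⟨ eSF≗e n x ⟨
    eSF n x                   ≡⟨ ⋆-identityʳ (eSF n) x ⟨
    (eSF n ⋆ oneSF) x         ≡⟨ ⊛≗⋆ (eSF n) oneSF x ⟨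
    eProd (n ∷ []) x          ∎

forgottenVia-not-SNP : ∀ n la → IsComposition n la → ∀ c → (∀ α → monoSF la α ≡ combE c α) →
  la ≢ replicate n 1 → ¬ SNP (forgottenVia la c)
forgottenVia-not-SNP zero    []          _              c m≡c la≢[] _   = la≢[] refl
forgottenVia-not-SNP zero    (zero ∷ _)  (() ∷ _ , _)
forgottenVia-not-SNP zero    (suc _ ∷ _) (_ , ())
forgottenVia-not-SNP (suc n) la          comp           c m≡c la≢1ⁿ snp =
  snp N (s≤s z≤n) (Vec.replicate N 1) (1ⁿ∈NewtonPolytope n (restrict N f) vertices≢0) f-at-1ⁿ≡0
  where
  N : ℕ
  N = suc n
  f : SF
  f = forgottenVia la c
  ε : ℤ
  ε = signPow (sumℕ la ∸ length la)
  f-at-1ⁿ≡0 : f (Vec.toList (Vec.replicate N 1)) ≡ 0ℤ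
  f-at-1ⁿ≡0 = begin
    f (Vec.toList (Vec.replicate N 1))
      ≡⟨ forgottenVia-ωcoeff la c m≡c _ ⟩
    ε * ωcoeff (Vec.toList (Vec.replicate N 1)) (monoSF la)
      ≡⟨ cong (λ α → ε * ωcoeff α (monoSF la)) (VecP.toList-replicate N 1) ⟩
    ε * ωcoeff (replicate N 1) (monoSF la)
      ≡⟨ cong (ε *_) (trans (ωcoeff-1ⁿ N (monoSF la)) (monoSF-at-1ⁿ la N la≢1ⁿ)) ⟩
    ε * 0ℤ
      ≡⟨ ℤP.*-zeroʳ ε ⟩
    0ℤ ∎
    where open ≡-Reasoning
  vertices≢0 : ∀ i → f (Vec.toList (scaledUnit i N)) ≢ 0ℤ
  vertices≢0 i f≡0 = *-≢0 (signPow≢0 (sumℕ la ∸ length la)) (ωStep-monoSF≢0 N la comp) (begin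
    ε * ωStep N N (monoSF la) []                       ≡⟨ cong (ε *_) (ωcoeff-scaledUnit i N (monoSF la)) ⟨
    ε * ωcoeff (Vec.toList (scaledUnit i N)) (monoSF la) ≡⟨ forgottenVia-ωcoeff la c m≡c _ ⟨
    f (Vec.toList (scaledUnit i N))                    ≡⟨ f≡0 ⟩
    0ℤ                                                 ∎)
    where open ≡-Reasoning

proposition2p13 : (n : ℕ) (la : List ℕ) → IsPartition n la →
    (c : List (ℤ × List ℕ)) → (∀ α → monoSF la α ≡ combE c α) →
    SNP (forgottenVia la c) ⇔ (la ≡ replicate n 1)
proposition2p13 n la (_ , comp) c m≡c = mk⇔ only-if if
  where
  only-if : SNP (forgottenVia la c) → la ≡ replicate n 1
  only-if snp = decidable-stable (≡-dec ℕ._≟_ la (replicate n 1))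
                                 (λ la≢1ⁿ → forgottenVia-not-SNP n la comp c m≡c la≢1ⁿ snp)
  if : la ≡ replicate n 1 → SNP (forgottenVia la c)
  if refl = ≗hSF⇒SNP n (forgottenVia-1ⁿ n c m≡c)
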